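{- Let $R$ be a consistent triple set and $ab|c\in R$. Let $C_{a,b}$ (resp. $C_c$) be the connected component of the Ahograph $[R,L_R]$ containing $a$ and $b$ (resp. $c$); possibly $C_{a,b}=C_c$. Suppose (S1) $[R,L_R]$ contains no cycle, and (S2) whenever $ab|d\in R$ with $d\ne c$, then $d\notin C_{a,b}\cup C_c$. Then $ab|c\in\bigcap_{R'\in\min(\mathfrak{sc}(R))}R'$. Moreover, $\bigcap_{R'\in\min(\mathfrak{sc}(R))}R'=\bigcap_{R'\in\mathfrak{sc}(R)}R'$.
   Context: A rooted tree $T$ has a distinguished inner vertex (root); leaves are degree-1 vertices; inner vertices other than the root have degree at least 3. A triple $ab|c$ is the rooted binary tree on leaves $a,b,c$ where the path from $a$ to $b$ avoids the path from $c$ to the root; $ab|c=ba|c$. A rooted tree displays $ab|c$ if $a,b,c$ are leaves and the path from $a$ to $b$ does not intersect the path from $c$ to the root; $\mathcal R(T)$ is the set of displayed triples. A triple set is consistent if some rooted tree displays all its triples. $L_R$ is the set of leaves appearing in $R$. $\mathrm{cl}(R)=\bigcap\mathcal R(T)$ over rooted trees $T$ with leaf set $L_R$ displaying $R$. $\mathfrak{sc}(R)=\{R'\subseteq R:\mathrm{cl}(R')=\mathrm{cl}(R)\}$; $\min(\mathfrak{sc}(R))$ is the set of its inclusion-minimal elements. For $\mathcal L\subseteq L_R$, the Ahograph $[R,\mathcal L]$ is the graph with vertex set $\mathcal L$ in which distinct $x,y\in\mathcal L$ are adjacent iff some $xy|z\in R$ has $z\in\mathcal L$. -}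

module Defs where

open import Data.Nat using (ℕ; _≤_)
open import Data.List using (List; []; _∷_; _++_; length; lookup)
open import Data.List.Relation.Unary.All using (All)
open import Data.List.Relation.Unary.Any using (Any)
open import Data.List.Relation.Unary.Unique.Propositional using (Unique)
open import Data.List.Membership.Propositional using (_∈_; _∉_)
open import Data.Product using (Σ; ∃; ∃-syntax; _×_; _,_)
open import Data.Sum using (_⊎_)
open import Data.Unit using (⊤)
open import Data.Empty using (⊥)
open import Data.Fin using (Fin)
open import Data.Fin.Subset as Sub using (Subset)
open import Relation.Nullary using (¬_)
open import Relation.Binary.PropositionalEquality using (_≡_; _≢_)
open import Function.Bundles using (_⇔_)

-- A triple ab|c (written  tr a b c ).  ab|c = ba|c is handled by _≈T_.
record Triple : Set where
  constructor tr
  field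
    ta tb tc : ℕ

open Triple public

_≈T_ : Triple → Triple → Set
tr a b c ≈T tr a' b' c' = c ≡ c' × ((a ≡ a' × b ≡ b') ⊎ (a ≡ b' × b ≡ a'))

_∈T_ : Triple → List Triple → Set
t ∈T R = Any (t ≈T_) R

_inTriple_ : ℕ → Triple → Set
x inTriple tr a b c = x ≡ a ⊎ x ≡ b ⊎ x ≡ c

data Tree : Set where
  leaf : ℕ → Tree
  node : List Tree → Tree

mutual
  leaves : Tree → List ℕ
  leaves (leaf x)  = x ∷ []
  leaves (node ts) = leavesL ts

  leavesL : List Tree → List ℕ
  leavesL []       = []
  leavesL (t ∷ ts) = leaves t ++ leavesL ts

-- every internal node has at least two children; hence the root has
-- degree >= 2 and every non-root inner vertex degree >= 3
data WfT : Tree → Set where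
  wleaf : ∀ {x} → WfT (leaf x)
  wnode : ∀ {ts} → 2 ≤ length ts → All WfT ts → WfT (node ts)

data IsNode : Tree → Set where
  isNode : ∀ {ts} → IsNode (node ts)

RootedTree : Tree → Set
RootedTree T = IsNode T × WfT T × Unique (leaves T)

data _⊑_ : Tree → Tree → Set where
  here  : ∀ {T} → T ⊑ T
  there : ∀ {s t ts} → t ∈ ts → s ⊑ t → s ⊑ node ts

-- T displays ab|c : a,b,c leaves, a ≠ b, and some vertex (namely a vertex
-- on the a–b path, e.g. lca(a,b)) has a,b but not c below it, i.e. the
-- a–b path avoids the path from c to the root.
Displays : Tree → Triple → Set
Displays T (tr a b c) =
  a ≢ b × a ∈ leaves T × b ∈ leaves T × c ∈ leaves T ×
  ∃[ s ] (s ⊑ T × a ∈ leaves s × b ∈ leaves s × c ∉ leaves s)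

TSet : Set₁
TSet = Triple → Set

LeafSet : TSet → ℕ → Set
LeafSet P x = ∃[ t ] (P t × x inTriple t)

cl : TSet → TSet
cl P t = (T : Tree) → RootedTree T → (∀ x → (x ∈ leaves T) ⇔ LeafSet P x) →
         (∀ t' → P t' → Displays T t') → Displays T t

⟪_⟫ : List Triple → TSet
⟪ R ⟫ t = t ∈T R

Consistent : List Triple → Set
Consistent R = ∃[ T ] (RootedTree T × (∀ t → t ∈T R → Displays T t))

-- subsets R' ⊆ R, given by subsets of the index set of the list R
⟦_⟧_ : (R : List Triple) → Subset (length R) → TSet
(⟦ R ⟧ S) t = ∃[ i ] (i Sub.∈ S × lookup R i ≈T t)

InSc : (R : List Triple) → Subset (length R) → Set
InSc R S = ∀ t → cl (⟦ R ⟧ S) t ⇔ cl ⟪ R ⟫ t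

InMinSc : (R : List Triple) → Subset (length R) → Set
InMinSc R S = InSc R S × (∀ S' → S' Sub.⊆ S → InSc R S' → S Sub.⊆ S')

Adj : List Triple → ℕ → ℕ → Set
Adj R x y = x ≢ y × ∃[ z ] (tr x y z ∈T R × LeafSet ⟪ R ⟫ z)

data Reach (R : List Triple) : ℕ → ℕ → Set where
  refl : ∀ {x} → LeafSet ⟪ R ⟫ x → Reach R x x
  step : ∀ {x y z} → Adj R x y → Reach R y z → Reach R x z

Walk : List Triple → List ℕ → Set
Walk R []            = ⊤
Walk R (x ∷ [])      = ⊤
Walk R (x ∷ y ∷ vs)  = Adj R x y × Walk R (y ∷ vs)

HasCycle : List Triple → Set
HasCycle R = ∃[ x ] ∃[ y ] ∃[ z ] ∃[ vs ]
  (Unique (x ∷ y ∷ z ∷ vs) × Walk R (x ∷ y ∷ z ∷ vs ++ x ∷ []))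

module Submission where

-- Let Tᴿ display R and let R' ⊆ R with ab|c ∉ R'.  Put B = C_{a,b} ∪ C_c and let A be
-- the leaves reachable from a along Ahograph edges xy witnessed by some xy|z ≠ ab|c
-- with z ∈ B.  By (S2) and (S1), b ∉ A.  Restricting Tᴿ to L_{R'} and regrouping its
-- leaves as ((A, B∖A), rest) gives a tree that displays R' (B is a union of components,
-- A is closed under the relevant edges) but not ab|c, so ab|c ∉ cl(R') = cl(R) unless
-- R' = ∅, which cl(∅) ≠ cl(R) excludes.  The second claim holds because every member
-- of sc(R) contains a minimal one.  Membership in R' is decidable, so we may argue
-- classically about finitely many leaves.

open import Defs
open import Data.Nat using (ℕ; _<_; s≤s; z≤n) renaming (_≟_ to _≟ℕ_)
open import Data.Nat.Induction using (<-wellFounded)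
open import Data.Bool using (Bool; true; false; not; if_then_else_; T; T?)
open import Data.Bool.Properties using (T-≡; T-not-≡; ⇔→≡) renaming (_≟_ to _≟ᵇ_)
open import Data.Maybe using (Maybe; just; nothing)
open import Data.List using (List; []; _∷_; _++_; length; lookup; filterᵇ)
open import Data.List.Properties using (++-identityʳ; filter-++)
open import Data.List.Relation.Unary.Any using (here; there)
open import Data.List.Relation.Unary.All using (All; []; _∷_)
open import Data.List.Relation.Unary.All.Properties using (¬Any⇒All¬)
open import Data.List.Relation.Unary.AllPairs using ([]; _∷_)
open import Data.List.Relation.Unary.Unique.Propositional using (Unique)
open import Data.List.Relation.Unary.Unique.Propositional.Properties using (filter⁺; ++⁺)
open import Data.List.Membership.Propositional using (_∈_; _∉_)
open import Data.List.Membership.Propositional.Properties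
  using (∈-++⁺ˡ; ∈-++⁺ʳ; ∈-++⁻; ∈-filter⁺; ∈-filter⁻)
open import Data.List.Membership.DecPropositional _≟ℕ_ using () renaming (_∈?_ to _∈ₗ?_)
open import Data.Fin using (zero; suc)
open import Data.Fin.Properties using (any?)
open import Data.Fin.Subset as Sub using (Subset; ∣_∣; _⊆_; _⊂_)
open import Data.Fin.Subset.Properties using (_∈?_; _⊆?_; _⊂?_; p⊂q⇒∣p∣<∣q∣)
open import Data.Product using (Σ; ∃-syntax; _×_; _,_; proj₁; proj₂; map₁; map₂)
open import Data.Sum using (_⊎_; inj₁; inj₂)
open import Data.Unit using (⊤; tt)
open import Data.Empty using (⊥; ⊥-elim)
open import Function using (_∘_)
open import Function.Bundles using (_⇔_; mk⇔; Equivalence)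
open import Function.Properties.Equivalence using () renaming (trans to ⇔-trans)
open import Induction.WellFounded using (Acc; acc)
open import Relation.Binary.Construct.Closure.ReflexiveTransitive using (Star; ε; _◅_; _◅◅_)
open import Relation.Nullary using (¬_; Dec; yes; no)
open import Relation.Nullary.Decidable
  using (decidable-stable; ¬¬-excluded-middle; _×-dec_; _⊎-dec_; isYes; toWitness; fromWitness)
open import Relation.Nullary.Negation using (contradiction; ¬¬-map)
open import Relation.Binary.PropositionalEquality
  using (_≡_; _≢_; refl; sym; trans; cong; cong₂; subst; module ≡-Reasoning)

open Equivalence using (to; from)

≈T-refl : ∀ {t} → t ≈T t
≈T-refl {tr _ _ _} = refl , inj₁ (refl , refl)

≈T-sym : ∀ {s t} → s ≈T t → t ≈T s
≈T-sym {tr _ _ _} {tr _ _ _} (refl , inj₁ (refl , refl)) = refl , inj₁ (refl , refl)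
≈T-sym {tr _ _ _} {tr _ _ _} (refl , inj₂ (refl , refl)) = refl , inj₂ (refl , refl)

≈T-trans : ∀ {s t u} → s ≈T t → t ≈T u → s ≈T u
≈T-trans {tr _ _ _} {tr _ _ _} {tr _ _ _} (refl , inj₁ (refl , refl)) q = q
≈T-trans {tr _ _ _} {tr _ _ _} {tr _ _ _} (refl , inj₂ (refl , refl)) (refl , inj₁ (refl , refl)) =
  refl , inj₂ (refl , refl)
≈T-trans {tr _ _ _} {tr _ _ _} {tr _ _ _} (refl , inj₂ (refl , refl)) (refl , inj₂ (refl , refl)) =
  refl , inj₁ (refl , refl)

≈T-swap : ∀ x y z → tr y x z ≈T tr x y z
≈T-swap x y z = refl , inj₂ (refl , refl)

_≈T?_ : ∀ s t → Dec (s ≈T t)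
tr a b c ≈T? tr a′ b′ c′ =
  (c ≟ℕ c′) ×-dec (((a ≟ℕ a′) ×-dec (b ≟ℕ b′)) ⊎-dec ((a ≟ℕ b′) ×-dec (b ≟ℕ a′)))

∈T-resp : ∀ {s t R} → s ≈T t → t ∈T R → s ∈T R
∈T-resp e (here p) = here (≈T-trans e p)
∈T-resp e (there q) = there (∈T-resp e q)

∈T-swap : ∀ {x y z R} → tr x y z ∈T R → tr y x z ∈T R
∈T-swap {x} {y} {z} = ∈T-resp (≈T-swap x y z)

lookup-∈T : ∀ R i {t} → lookup R i ≈T t → t ∈T R
lookup-∈T (r ∷ R) zero e = here (≈T-sym e)
lookup-∈T (r ∷ R) (suc i) e = there (lookup-∈T R i e)

leafˡ : ∀ {P x y z} → P (tr x y z) → LeafSet P x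
leafˡ Pt = _ , Pt , inj₁ refl

leafʳ : ∀ {P x y z} → P (tr x y z) → LeafSet P y
leafʳ Pt = _ , Pt , inj₂ (inj₁ refl)

leafᶜ : ∀ {P x y z} → P (tr x y z) → LeafSet P z
leafᶜ Pt = _ , Pt , inj₂ (inj₂ refl)

∈⟦_⟧? : ∀ R S t → Dec ((⟦ R ⟧ S) t)
∈⟦ R ⟧? S t = any? (λ i → (i ∈? S) ×-dec (lookup R i ≈T? t))

Char : (ℕ → Bool) → (ℕ → Set) → List ℕ → Set
Char f P xs = ∀ {x} → x ∈ xs → T (f x) ⇔ P x

DecidableOn : (ℕ → Set) → List ℕ → Set
DecidableOn P xs = ∀ {x} → x ∈ xs → Dec (P x)

¬¬-decidable-on : (P : ℕ → Set) (xs : List ℕ) → ¬ ¬ DecidableOn P xs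
¬¬-decidable-on P [] k = k λ ()
¬¬-decidable-on P (x ∷ xs) k =
  ¬¬-excluded-middle λ Px? → ¬¬-decidable-on P xs λ P? →
  k λ { (here refl) → Px? ; (there x∈) → P? x∈ }

-- Hence, when proving a stable goal, every predicate has a characteristic
-- function on a finite list; we use this for L_{R'}, B and A below.
¬¬-char : (P : ℕ → Set) (xs : List ℕ) → ¬ ¬ (Σ (ℕ → Bool) λ f → Char f P xs)
¬¬-char P xs = ¬¬-map characteristic (¬¬-decidable-on P xs)
  where
  χ : DecidableOn P xs → ℕ → Bool
  χ P? x with x ∈ₗ? xs
  ... | yes x∈ = isYes (P? x∈)
  ... | no _ = false

  χ-char : (P? : DecidableOn P xs) → Char (χ P?) P xs
  χ-char P? {x} x∈ with x ∈ₗ? xs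
  ... | yes _ = mk⇔ toWitness fromWitness
  ... | no x∉ = contradiction x∈ x∉

  characteristic : DecidableOn P xs → Σ (ℕ → Bool) λ f → Char f P xs
  characteristic P? = χ P? , χ-char P?

char-transfer : ∀ {f P xs x y} → Char f P xs → x ∈ xs → y ∈ xs → f x ≡ f y → P x → P y
char-transfer χ x∈ y∈ fx≡fy Px = to (χ y∈) (subst T fx≡fy (from (χ x∈) Px))

char-≡ : ∀ {f P xs x y} → Char f P xs → x ∈ xs → y ∈ xs → (P x ⇔ P y) → f x ≡ f y
char-≡ {f} {P} {xs} χ x∈ y∈ Px⇔Py =
  ⇔→≡ (mk⇔ (through (to Px⇔Py) x∈ y∈) (through (from Px⇔Py) y∈ x∈))
  where
  through : ∀ {u v} → (P u → P v) → u ∈ xs → v ∈ xs → f u ≡ true → f v ≡ true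
  through g u∈ v∈ e = to T-≡ (from (χ v∈) (g (to (χ u∈) (from T-≡ e))))

-- Partial trees.
-- A partial tree is a tree or the empty tree; restricting a tree to a set of
-- leaves may produce the empty tree.

mleaves : Maybe Tree → List ℕ
mleaves nothing = []
mleaves (just t) = leaves t

MWf : Maybe Tree → Set
MWf nothing = ⊤
MWf (just t) = WfT t

collapse : List Tree → Maybe Tree
collapse [] = nothing
collapse (t ∷ []) = just t
collapse ts@(_ ∷ _ ∷ _) = just (node ts)

join : Maybe Tree → Maybe Tree → Maybe Tree
join nothing v = v
join (just t) nothing = just t
join (just t) (just u) = just (node (t ∷ u ∷ []))

_?∷_ : Maybe Tree → List Tree → List Tree
nothing ?∷ ts = ts
just t ?∷ ts = t ∷ ts

mutual
  restrict : (ℕ → Bool) → Tree → Maybe Tree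
  restrict p (leaf x) = if p x then just (leaf x) else nothing
  restrict p (node ts) = collapse (restrictL p ts)

  restrictL : (ℕ → Bool) → List Tree → List Tree
  restrictL p [] = []
  restrictL p (t ∷ ts) = restrict p t ?∷ restrictL p ts

_∣_ : Maybe Tree → (ℕ → Bool) → Maybe Tree
nothing ∣ p = nothing
just t ∣ p = restrict p t

leaves-collapse : ∀ ts → mleaves (collapse ts) ≡ leavesL ts
leaves-collapse [] = refl
leaves-collapse (t ∷ []) = sym (++-identityʳ (leaves t))
leaves-collapse (_ ∷ _ ∷ _) = refl

leaves-?∷ : ∀ m ts → leavesL (m ?∷ ts) ≡ mleaves m ++ leavesL ts
leaves-?∷ nothing ts = refl
leaves-?∷ (just t) ts = refl

mutual
  leaves-restrict : ∀ p t → mleaves (restrict p t) ≡ filterᵇ p (leaves t)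
  leaves-restrict p (leaf x) with p x
  ... | true = refl
  ... | false = refl
  leaves-restrict p (node ts) = trans (leaves-collapse (restrictL p ts)) (leaves-restrictL p ts)

  leaves-restrictL : ∀ p ts → leavesL (restrictL p ts) ≡ filterᵇ p (leavesL ts)
  leaves-restrictL p [] = refl
  leaves-restrictL p (t ∷ ts) = begin
    leavesL (restrict p t ?∷ restrictL p ts)
      ≡⟨ leaves-?∷ (restrict p t) (restrictL p ts) ⟩
    mleaves (restrict p t) ++ leavesL (restrictL p ts)
      ≡⟨ cong₂ _++_ (leaves-restrict p t) (leaves-restrictL p ts) ⟩
    filterᵇ p (leaves t) ++ filterᵇ p (leavesL ts)
      ≡⟨ filter-++ (T? ∘ p) (leaves t) (leavesL ts) ⟨
    filterᵇ p (leaves t ++ leavesL ts) ∎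
    where open ≡-Reasoning

leaves-∣ : ∀ m p → mleaves (m ∣ p) ≡ filterᵇ p (mleaves m)
leaves-∣ nothing p = refl
leaves-∣ (just t) p = leaves-restrict p t

leaves-join : ∀ u v → mleaves (join u v) ≡ mleaves u ++ mleaves v
leaves-join nothing v = refl
leaves-join (just t) nothing = sym (++-identityʳ (leaves t))
leaves-join (just t) (just u) = cong (leaves t ++_) (++-identityʳ (leaves u))

∈-∣ : ∀ m p {x} → x ∈ mleaves (m ∣ p) ⇔ (x ∈ mleaves m × T (p x))
∈-∣ m p {x} = mk⇔
  (λ x∈ → ∈-filter⁻ (T? ∘ p) (subst (x ∈_) (leaves-∣ m p) x∈))
  (λ (x∈ , px) → subst (x ∈_) (sym (leaves-∣ m p)) (∈-filter⁺ (T? ∘ p) x∈ px))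

∈-restrict : ∀ p t {t′} → restrict p t ≡ just t′ →
             ∀ {x} → x ∈ leaves t′ ⇔ (x ∈ leaves t × T (p x))
∈-restrict p t e {x} =
  subst (λ m → x ∈ mleaves m ⇔ (x ∈ leaves t × T (p x))) e (∈-∣ (just t) p)

∈-join : ∀ u v {x} → x ∈ mleaves (join u v) ⇔ (x ∈ mleaves u ⊎ x ∈ mleaves v)
∈-join u v {x} = mk⇔
  (λ x∈ → ∈-++⁻ (mleaves u) (subst (x ∈_) (leaves-join u v) x∈))
  (λ x∈ → subst (x ∈_) (sym (leaves-join u v)) (∈-++⁺ x∈))
  where
  ∈-++⁺ : x ∈ mleaves u ⊎ x ∈ mleaves v → x ∈ mleaves u ++ mleaves v
  ∈-++⁺ (inj₁ x∈u) = ∈-++⁺ˡ x∈u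
  ∈-++⁺ (inj₂ x∈v) = ∈-++⁺ʳ (mleaves u) x∈v

just-of-∈ : ∀ {m x} → x ∈ mleaves m → ∃[ t ] (m ≡ just t)
just-of-∈ {just t} _ = t , refl

-- Restriction and joining produce well-formed trees: contracting unary vertices
-- keeps every inner vertex of degree at least three.

wf-collapse : ∀ ts → All WfT ts → MWf (collapse ts)
wf-collapse [] _ = tt
wf-collapse (t ∷ []) (wf ∷ _) = wf
wf-collapse (_ ∷ _ ∷ _) wfs = wnode (s≤s (s≤s z≤n)) wfs

wf-?∷ : ∀ m ts → MWf m → All WfT ts → All WfT (m ?∷ ts)
wf-?∷ nothing ts _ wfs = wfs
wf-?∷ (just t) ts wf wfs = wf ∷ wfs

mutual
  wf-restrict : ∀ p t → MWf (restrict p t)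
  wf-restrict p (leaf x) with p x
  ... | true = wleaf
  ... | false = tt
  wf-restrict p (node ts) = wf-collapse (restrictL p ts) (wf-restrictL p ts)

  wf-restrictL : ∀ p ts → All WfT (restrictL p ts)
  wf-restrictL p [] = []
  wf-restrictL p (t ∷ ts) = wf-?∷ (restrict p t) (restrictL p ts) (wf-restrict p t) (wf-restrictL p ts)

wf-∣ : ∀ m p → MWf (m ∣ p)
wf-∣ nothing p = tt
wf-∣ (just t) p = wf-restrict p t

wf-join : ∀ u v → MWf u → MWf v → MWf (join u v)
wf-join nothing v _ wv = wv
wf-join (just t) nothing wt _ = wt
wf-join (just t) (just u) wt wu = wnode (s≤s (s≤s z≤n)) (wt ∷ wu ∷ [])

unique-∣ : ∀ m p → Unique (mleaves m) → Unique (mleaves (m ∣ p))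
unique-∣ m p u = subst Unique (sym (leaves-∣ m p)) (filter⁺ (T? ∘ p) u)

unique-join : ∀ u v → Unique (mleaves u) → Unique (mleaves v) →
              (∀ {x} → x ∈ mleaves u → x ∉ mleaves v) → Unique (mleaves (join u v))
unique-join u v uu uv disjoint =
  subst Unique (sym (leaves-join u v)) (++⁺ uu uv λ (x∈u , x∈v) → disjoint x∈u x∈v)

⊑-trans : ∀ {s t u} → s ⊑ t → t ⊑ u → s ⊑ u
⊑-trans s⊑t here = s⊑t
⊑-trans s⊑t (there v∈ t⊑v) = there v∈ (⊑-trans s⊑t t⊑v)

mutual
  ⊑-leaves : ∀ {s t x} → s ⊑ t → x ∈ leaves s → x ∈ leaves t
  ⊑-leaves here x∈ = x∈
  ⊑-leaves (there {ts = ts} u∈ s⊑u) x∈ = ∈-leavesL ts u∈ (⊑-leaves s⊑u x∈)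

  ∈-leavesL : ∀ ts {u x} → u ∈ ts → x ∈ leaves u → x ∈ leavesL ts
  ∈-leavesL (t ∷ ts) (here refl) x∈ = ∈-++⁺ˡ x∈
  ∈-leavesL (t ∷ ts) (there u∈) x∈ = ∈-++⁺ʳ (leaves t) (∈-leavesL ts u∈ x∈)

_⊑any_ : Tree → List Tree → Set
s ⊑any ts = ∃[ u ] (u ∈ ts × s ⊑ u)

⊑any-there : ∀ {s t ts} → s ⊑any ts → s ⊑any (t ∷ ts)
⊑any-there (u , u∈ , s⊑u) = u , there u∈ , s⊑u

collapse-child : ∀ ts {t} → t ∈ ts → ∃[ r ] (collapse ts ≡ just r × t ⊑ r)
collapse-child (t ∷ []) (here refl) = t , refl , here
collapse-child (_ ∷ _ ∷ _) t∈ = _ , refl , there t∈ here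

collapse-⊑⁻ : ∀ ts {r s} → collapse ts ≡ just r → s ⊑ r → s ≡ r ⊎ s ⊑any ts
collapse-⊑⁻ (t ∷ []) refl s⊑t = inj₂ (t , here refl , s⊑t)
collapse-⊑⁻ (_ ∷ _ ∷ _) refl here = inj₁ refl
collapse-⊑⁻ (_ ∷ _ ∷ _) refl (there u∈ s⊑u) = inj₂ (_ , u∈ , s⊑u)

restrictL-∈ : ∀ p ts {u u′} → u ∈ ts → restrict p u ≡ just u′ → u′ ∈ restrictL p ts
restrictL-∈ p (t ∷ ts) (here refl) e with restrict p t
restrictL-∈ p (t ∷ ts) (here refl) refl | just _ = here refl
restrictL-∈ p (t ∷ ts) (there u∈) e with restrict p t
... | nothing = restrictL-∈ p ts u∈ e
... | just _ = there (restrictL-∈ p ts u∈ e)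

restrict-⊑⁺ : ∀ p {s t s′} → s ⊑ t → restrict p s ≡ just s′ →
              ∃[ t′ ] (restrict p t ≡ just t′ × s′ ⊑ t′)
restrict-⊑⁺ p here e = _ , e , here
restrict-⊑⁺ p (there {ts = ts} u∈ s⊑u) e =
  let (u′ , eu , s′⊑u′) = restrict-⊑⁺ p s⊑u e
      (r , er , u′⊑r) = collapse-child (restrictL p ts) (restrictL-∈ p ts u∈ eu)
  in r , er , ⊑-trans s′⊑u′ u′⊑r

mutual
  restrict-⊑⁻ : ∀ p t {t′ s′} → restrict p t ≡ just t′ → s′ ⊑ t′ →
                ∃[ s ] (s ⊑ t × restrict p s ≡ just s′)
  restrict-⊑⁻ p (leaf x) e here = leaf x , here , e
  restrict-⊑⁻ p (leaf x) e (there _ _) with p x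
  restrict-⊑⁻ p (leaf x) () (there _ _) | true
  restrict-⊑⁻ p (leaf x) () (there _ _) | false
  restrict-⊑⁻ p (node ts) e s′⊑t′ with collapse-⊑⁻ (restrictL p ts) e s′⊑t′
  ... | inj₁ refl = node ts , here , e
  ... | inj₂ (u′ , u′∈ , s′⊑u′) =
    let (s , (u , u∈ , s⊑u) , es) = restrictL-⊑⁻ p ts u′∈ s′⊑u′ in s , there u∈ s⊑u , es

  restrictL-⊑⁻ : ∀ p ts {u′ s′} → u′ ∈ restrictL p ts → s′ ⊑ u′ →
                 ∃[ s ] (s ⊑any ts × restrict p s ≡ just s′)
  restrictL-⊑⁻ p (t ∷ ts) u′∈ s′⊑u′ with restrict p t in e
  ... | nothing = map₂ (map₁ ⊑any-there) (restrictL-⊑⁻ p ts u′∈ s′⊑u′)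
  ... | just t′ with u′∈
  ...   | here refl = let (s , s⊑t , es) = restrict-⊑⁻ p t e s′⊑u′ in s , (t , here refl , s⊑t) , es
  ...   | there u′∈′ = map₂ (map₁ ⊑any-there) (restrictL-⊑⁻ p ts u′∈′ s′⊑u′)

-- Separation.
-- A partial tree separates x, y from z if some subtree contains x and y but not z;
-- for a tree with leaves x ≠ y, z this is exactly the display of xy|z.

Separates : Maybe Tree → ℕ → ℕ → ℕ → Set
Separates nothing x y z = ⊥
Separates (just t) x y z = ∃[ s ] (s ⊑ t × x ∈ leaves s × y ∈ leaves s × z ∉ leaves s)

separates-leaves : ∀ m {x y z} → Separates m x y z → x ∈ mleaves m × y ∈ mleaves m
separates-leaves (just t) (s , s⊑t , x∈ , y∈ , _) = ⊑-leaves s⊑t x∈ , ⊑-leaves s⊑t y∈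

separates-whole : ∀ m {x y z} → x ∈ mleaves m → y ∈ mleaves m → z ∉ mleaves m → Separates m x y z
separates-whole (just t) x∈ y∈ z∉ = t , here , x∈ , y∈ , z∉

separates-∣⁺ : ∀ m p {x y z} → Separates m x y z → T (p x) → T (p y) → Separates (m ∣ p) x y z
separates-∣⁺ (just t) p {x} {y} {z} (s , s⊑t , x∈ , y∈ , z∉) px py =
  let (s′ , es) = just-of-∈ (from (∈-∣ (just s) p) (x∈ , px))
      (t′ , et , s′⊑t′) = restrict-⊑⁺ p s⊑t es
      in-s′ = ∈-restrict p s es
  in subst (λ m → Separates m x y z) (sym et)
       (s′ , s′⊑t′ , from in-s′ (x∈ , px) , from in-s′ (y∈ , py) , z∉ ∘ proj₁ ∘ to in-s′)

separates-∣⁻ : ∀ m p {x y z} → Separates (m ∣ p) x y z → T (p z) → Separates m x y z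
separates-∣⁻ (just t) p sep pz with restrict p t in et
... | just t′ =
  let (s′ , s′⊑t′ , x∈ , y∈ , z∉) = sep
      (s , s⊑t , es) = restrict-⊑⁻ p t et s′⊑t′
      in-s′ = ∈-restrict p s es
  in s , s⊑t , proj₁ (to in-s′ x∈) , proj₁ (to in-s′ y∈) , λ z∈ → z∉ (from in-s′ (z∈ , pz))

separates-joinˡ : ∀ u v {x y z} → Separates u x y z → Separates (join u v) x y z
separates-joinˡ (just t) nothing sep = sep
separates-joinˡ (just t) (just u) (s , s⊑t , sep) = s , there (here refl) s⊑t , sep

separates-joinʳ : ∀ u v {x y z} → Separates v x y z → Separates (join u v) x y z
separates-joinʳ nothing v sep = sep
separates-joinʳ (just t) (just u) (s , s⊑u , sep) = s , there (there (here refl)) s⊑u , sep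

separates-join⁻ : ∀ u v {x y z} → Separates (join u v) x y z → z ∈ mleaves (join u v) →
                  Separates u x y z ⊎ Separates v x y z
separates-join⁻ nothing v sep _ = inj₂ sep
separates-join⁻ (just t) nothing sep _ = inj₁ sep
separates-join⁻ (just t) (just u) (s , here , _ , _ , z∉) z∈ = contradiction z∈ z∉
separates-join⁻ (just t) (just u) (s , there (here refl) s⊑t , sep) _ = inj₁ (s , s⊑t , sep)
separates-join⁻ (just t) (just u) (s , there (there (here refl)) s⊑u , sep) _ = inj₂ (s , s⊑u , sep)

-- Splitting.
-- split p m regroups the leaves of m into two clusters: those satisfying p and
-- the others, each keeping the shape it has in m.

split : (ℕ → Bool) → Maybe Tree → Maybe Tree
split p m = join (m ∣ p) (m ∣ (not ∘ p))

∈-split : ∀ p m {x} → x ∈ mleaves (split p m) ⇔ x ∈ mleaves m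
∈-split p m {x} = mk⇔ out into
  where
  out : x ∈ mleaves (split p m) → x ∈ mleaves m
  out x∈ with to (∈-join (m ∣ p) (m ∣ (not ∘ p))) x∈
  ... | inj₁ x∈ₚ = proj₁ (to (∈-∣ m p) x∈ₚ)
  ... | inj₂ x∈ₙ = proj₁ (to (∈-∣ m (not ∘ p)) x∈ₙ)

  into : x ∈ mleaves m → x ∈ mleaves (split p m)
  into x∈ with p x in px
  ... | true = from (∈-join (m ∣ p) (m ∣ (not ∘ p)))
                     (inj₁ (from (∈-∣ m p) (x∈ , from T-≡ px)))
  ... | false = from (∈-join (m ∣ p) (m ∣ (not ∘ p)))
                      (inj₂ (from (∈-∣ m (not ∘ p)) (x∈ , from T-not-≡ px)))

unique-split : ∀ p m → Unique (mleaves m) → Unique (mleaves (split p m))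
unique-split p m u = unique-join (m ∣ p) (m ∣ (not ∘ p)) (unique-∣ m p u) (unique-∣ m (not ∘ p) u)
  λ x∈ₚ x∈ₙ → contradiction (to T-≡ (proj₂ (to (∈-∣ m p) x∈ₚ)))
                            (λ px → subst T (cong not px) (proj₂ (to (∈-∣ m (not ∘ p)) x∈ₙ)))

wf-split : ∀ p m → MWf (split p m)
wf-split p m = wf-join (m ∣ p) (m ∣ (not ∘ p)) (wf-∣ m p) (wf-∣ m (not ∘ p))

separates-split-part : ∀ p m {x y z} → Separates m x y z → p x ≡ p y → Separates (split p m) x y z
separates-split-part p m {x} sep pxy with p x in px
... | true = separates-joinˡ (m ∣ p) (m ∣ (not ∘ p))
               (separates-∣⁺ m p sep (from T-≡ px) (from T-≡ (sym pxy)))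
... | false = separates-joinʳ (m ∣ p) (m ∣ (not ∘ p))
                (separates-∣⁺ m (not ∘ p) sep (from T-not-≡ px) (from T-not-≡ (sym pxy)))

separates-split-root : ∀ p m {x y z} → x ∈ mleaves m → y ∈ mleaves m → z ∈ mleaves m →
                       p x ≡ p y → p x ≢ p z → Separates (split p m) x y z
separates-split-root p m {x} {y} {z} x∈ y∈ z∈ pxy px≢pz with p x in px | p z in pz
... | true | true = contradiction refl px≢pz
... | false | false = contradiction refl px≢pz
... | true | false = separates-joinˡ (m ∣ p) (m ∣ (not ∘ p)) (separates-whole (m ∣ p)
  (from (∈-∣ m p) (x∈ , from T-≡ px)) (from (∈-∣ m p) (y∈ , from T-≡ (sym pxy)))
  (λ z∈ₚ → subst T pz (proj₂ (to (∈-∣ m p) z∈ₚ))))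
... | false | true = separates-joinʳ (m ∣ p) (m ∣ (not ∘ p)) (separates-whole (m ∣ (not ∘ p))
  (from (∈-∣ m (not ∘ p)) (x∈ , from T-not-≡ px))
  (from (∈-∣ m (not ∘ p)) (y∈ , from T-not-≡ (sym pxy)))
  (λ z∈ₙ → subst (T ∘ not) pz (proj₂ (to (∈-∣ m (not ∘ p)) z∈ₙ))))

separates-split⁻ : ∀ p m {x y z} → Separates (split p m) x y z → z ∈ mleaves (split p m) →
                   p x ≡ p y × (p z ≡ p x → Separates m x y z)
separates-split⁻ p m {x} {y} {z} sep z∈ with separates-join⁻ (m ∣ p) (m ∣ (not ∘ p)) sep z∈
... | inj₁ sepₚ =
  let (x∈ , y∈) = separates-leaves (m ∣ p) sepₚ
      px = proj₂ (to (∈-∣ m p) x∈)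
  in trans (to T-≡ px) (sym (to T-≡ (proj₂ (to (∈-∣ m p) y∈))))
   , λ pzx → separates-∣⁻ m p sepₚ (subst T (sym pzx) px)
... | inj₂ sepₙ =
  let (x∈ , y∈) = separates-leaves (m ∣ (not ∘ p)) sepₙ
      ¬px = proj₂ (to (∈-∣ m (not ∘ p)) x∈)
  in trans (to T-not-≡ ¬px) (sym (to T-not-≡ (proj₂ (to (∈-∣ m (not ∘ p)) y∈))))
   , λ pzx → separates-∣⁻ m (not ∘ p) sepₙ (subst (T ∘ not) (sym pzx) ¬px)

DisplaysM : Maybe Tree → Triple → Set
DisplaysM nothing _ = ⊥
DisplaysM (just t) τ = Displays t τ

displaysM⁺ : ∀ m {x y z} → x ≢ y → x ∈ mleaves m → y ∈ mleaves m → z ∈ mleaves m →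
             Separates m x y z → DisplaysM m (tr x y z)
displaysM⁺ (just t) x≢y x∈ y∈ z∈ sep = x≢y , x∈ , y∈ , z∈ , sep

displaysM⁻ : ∀ m {x y z} → DisplaysM m (tr x y z) → x ≢ y × z ∈ mleaves m × Separates m x y z
displaysM⁻ (just t) (x≢y , _ , _ , z∈ , sep) = x≢y , z∈ , sep

record OnLeafSet (P : TSet) (m : Maybe Tree) : Set where
  field
    wf : MWf m
    unique : Unique (mleaves m)
    leafset : ∀ {x} → x ∈ mleaves m ⇔ LeafSet P x

split-onLeafSet : ∀ {P m} p → OnLeafSet P m → OnLeafSet P (split p m)
split-onLeafSet {m = m} p onP = record
  { wf = wf-split p m
  ; unique = unique-split p m unique
  ; leafset = ⇔-trans (∈-split p m) leafset
  }
  where open OnLeafSet onP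

rooted : ∀ m {x y} → MWf m → Unique (mleaves m) → x ∈ mleaves m → y ∈ mleaves m → x ≢ y →
         ∃[ t ] (m ≡ just t × RootedTree t)
rooted (just (leaf w)) _ _ (here refl) (here refl) x≢y = contradiction refl x≢y
rooted (just (node ts)) wf u _ _ _ = node ts , refl , isNode , wf , u

-- A partial tree on L_P displaying all of a nonempty P is a rooted tree
-- admissible in the definition of cl(P), so it displays all of cl(P).
cl-displayed : ∀ {P m t₀} → OnLeafSet P m → (∀ {t} → P t → DisplaysM m t) → P t₀ →
               ∀ {t} → cl P t → DisplaysM m t
cl-displayed {m = m} {t₀ = tr _ _ _} onP dispP Pt₀ clt
  with (x≢y , _ , sep) ← displaysM⁻ m (dispP Pt₀)
  with (x∈ , y∈) ← separates-leaves m sep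
  with (t , refl , rt) ← rooted m (OnLeafSet.wf onP) (OnLeafSet.unique onP) x∈ y∈ x≢y
  = clt t rt (λ _ → OnLeafSet.leafset onP) (λ _ → dispP)

displayed-leaf : ∀ {t τ x} → Displays t τ → x inTriple τ → x ∈ leaves t
displayed-leaf {τ = tr _ _ _} (_ , x∈ , _ , _ , _) (inj₁ refl) = x∈
displayed-leaf {τ = tr _ _ _} (_ , _ , y∈ , _ , _) (inj₂ (inj₁ refl)) = y∈
displayed-leaf {τ = tr _ _ _} (_ , _ , _ , z∈ , _) (inj₂ (inj₂ refl)) = z∈

some-leaf : ∀ {t} → WfT t → ∃[ x ] (x ∈ leaves t)
some-leaf (wleaf {x}) = x , here refl
some-leaf (wnode {_ ∷ _} _ (wf ∷ _)) = let (x , x∈) = some-leaf wf in x , ∈-++⁺ˡ x∈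

-- no rooted tree has an empty leaf set, so cl(∅) contains every triple
cl-of-empty : ∀ {P} → (∀ {t} → ¬ P t) → ∀ t → cl P t
cl-of-empty noP _ _ (_ , wf , _) leafset _ =
  let (x , x∈) = some-leaf wf
      (_ , Pτ , _) = to (leafset x) x∈
  in ⊥-elim (noP Pτ)

cl-extensive : ∀ {P t} → P t → cl P t
cl-extensive Pt _ _ _ dispP = dispP _ Pt

module Ahograph (R : List Triple) where

  reach-leaf : ∀ {x y} → Reach R x y → LeafSet ⟪ R ⟫ y
  reach-leaf (refl ly) = ly
  reach-leaf (step _ r) = reach-leaf r

  reach-snoc : ∀ {u x y} → Reach R u x → Adj R x y → Reach R u y
  reach-snoc (refl _) adj@(_ , _ , m , _) = step adj (refl (leafʳ m))
  reach-snoc (step adj r) adj′ = step adj (reach-snoc r adj′)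

  module SimplePaths (E : ℕ → ℕ → Set) (E⊆Adj : ∀ {x y} → E x y → Adj R x y) where

    -- an E-path from x to y whose vertices after x are vs
    data Path : ℕ → ℕ → List ℕ → Set where
      end  : ∀ {x} → Path x x []
      _∷ₚ_ : ∀ {x y z vs} → E x y → Path y z vs → Path x z (y ∷ vs)

    suffix : ∀ {x y w vs} → Path y w vs → x ∈ y ∷ vs → Unique (y ∷ vs) →
             ∃[ ws ] (Path x w ws × Unique (x ∷ ws))
    suffix p (here refl) u = _ , p , u
    suffix (e ∷ₚ p) (there x∈) (_ ∷ u) = suffix p x∈ u

    shortcut : ∀ {x y} → Star E x y → ∃[ vs ] (Path x y vs × Unique (x ∷ vs))
    shortcut ε = [] , end , [] ∷ []
    shortcut {x} (e ◅ s) with shortcut s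
    ... | vs , p , u with x ∈ₗ? (_ ∷ vs)
    ...   | yes x∈ = suffix p x∈ u
    ...   | no x∉ = _ , e ∷ₚ p , ¬Any⇒All¬ _ x∉ ∷ u

    path-walk : ∀ {x y w vs} → Path x y vs → Adj R y w → Walk R (x ∷ vs ++ w ∷ [])
    path-walk end adj = adj , tt
    path-walk (e ∷ₚ p) adj = E⊆Adj e , path-walk p adj

    walk-cycle : ∀ {x y} → Star E x y → x ≢ y → ¬ E x y → Adj R y x → HasCycle R
    walk-cycle s x≢y ¬e adj with shortcut s
    ... | _ , end , _ = contradiction refl x≢y
    ... | _ , e ∷ₚ end , _ = contradiction e ¬e
    ... | _ , p@(_ ∷ₚ (_ ∷ₚ _)) , u = _ , _ , _ , _ , u , path-walk p adj

module MinimalMembers (R : List Triple) where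

  strict : ∀ {S′ S : Subset (length R)} → S′ ⊆ S → ¬ (S ⊆ S′) → S′ ⊂ S
  strict {S′} {S} S′⊆S S⊈S′ = decidable-stable (S′ ⊂? S) λ S′⊄S →
    S⊈S′ λ {i} i∈S → decidable-stable (i ∈? S′) λ i∉S′ → S′⊄S (S′⊆S , i , i∈S , i∉S′)

  SmallerMember : Subset (length R) → Set
  SmallerMember S = ∃[ S′ ] (S′ ⊂ S × InSc R S′)

  ¬¬-minimal-below : ∀ S → Acc _<_ ∣ S ∣ → InSc R S → ¬ ¬ (∃[ S₀ ] (S₀ ⊆ S × InMinSc R S₀))
  ¬¬-minimal-below S (acc smaller) scS k = ¬¬-excluded-middle {A = SmallerMember S} λ where
    (yes (S′ , S′⊂S , scS′)) →
      ¬¬-minimal-below S′ (smaller (p⊂q⇒∣p∣<∣q∣ S′⊂S)) scS′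
        λ (S₀ , S₀⊆S′ , minS₀) → k (S₀ , proj₁ S′⊂S ∘ S₀⊆S′ , minS₀)
    (no none) →
      k (S , (λ i∈ → i∈) , scS , λ S′ S′⊆S scS′ →
        decidable-stable (S ⊆? S′) λ S⊈S′ → none (S′ , strict S′⊆S S⊈S′ , scS′))

  ⋂-minimal⇔⋂-sc : ∀ t → (((S : Subset (length R)) → InMinSc R S → (⟦ R ⟧ S) t) ⇔
                          ((S : Subset (length R)) → InSc R S → (⟦ R ⟧ S) t))
  ⋂-minimal⇔⋂-sc t = mk⇔ fromMinimal (λ h S minS → h S (proj₁ minS))
    where
    fromMinimal : ((S : Subset (length R)) → InMinSc R S → (⟦ R ⟧ S) t) →
                  (S : Subset (length R)) → InSc R S → (⟦ R ⟧ S) t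
    fromMinimal h S scS = decidable-stable (∈⟦ R ⟧? S t) λ t∉S →
      ¬¬-minimal-below S (<-wellFounded ∣ S ∣) scS λ (S₀ , S₀⊆S , minS₀) →
        let (i , i∈S₀ , e) = h S₀ minS₀ in t∉S (i , S₀⊆S i∈S₀ , e)

module Separation (R : List Triple) (Tᴿ : Tree) (Tᴿ-rooted : RootedTree Tᴿ)
  (Tᴿ-displays : ∀ t → t ∈T R → Displays Tᴿ t) (a b c : ℕ) (abc∈R : tr a b c ∈T R)
  (acyclic : ¬ HasCycle R)
  (S2 : ∀ d → tr a b d ∈T R → d ≢ c → ¬ (Reach R a d ⊎ Reach R c d)) where

  open Ahograph R

  l : List ℕ
  l = leaves Tᴿ

  leaf-of-Tᴿ : ∀ {x} → LeafSet ⟪ R ⟫ x → x ∈ l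
  leaf-of-Tᴿ (τ , τ∈R , x∈τ) = displayed-leaf (Tᴿ-displays τ τ∈R) x∈τ

  module Restriction {P : TSet} (P⊆R : ∀ {t} → P t → t ∈T R) {f : ℕ → Bool}
                     (χ : Char f (LeafSet P) l) where

    Tᴿ∣P : Maybe Tree
    Tᴿ∣P = just Tᴿ ∣ f

    onLeafSet : OnLeafSet P Tᴿ∣P
    onLeafSet = record
      { wf = wf-∣ (just Tᴿ) f
      ; unique = unique-∣ (just Tᴿ) f (proj₂ (proj₂ Tᴿ-rooted))
      ; leafset = mk⇔ (λ x∈ → let (x∈l , fx) = to (∈-∣ (just Tᴿ) f) x∈ in to (χ x∈l) fx)
                      (λ Px → let x∈l = leaf-of-P Px
                              in from (∈-∣ (just Tᴿ) f) (x∈l , from (χ x∈l) Px))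
      }
      where
      leaf-of-P : ∀ {x} → LeafSet P x → x ∈ l
      leaf-of-P (τ , Pτ , x∈τ) = leaf-of-Tᴿ (τ , P⊆R Pτ , x∈τ)

    in-Tᴿ∣P : ∀ {x} → LeafSet P x → x ∈ mleaves Tᴿ∣P
    in-Tᴿ∣P = from (OnLeafSet.leafset onLeafSet)

    displays : ∀ {t} → P t → DisplaysM Tᴿ∣P t
    displays {tr x y z} Pt =
      let (x≢y , x∈l , y∈l , _ , sep) = Tᴿ-displays _ (P⊆R Pt)
      in displaysM⁺ Tᴿ∣P x≢y
           (in-Tᴿ∣P (leafˡ {P} Pt)) (in-Tᴿ∣P (leafʳ {P} Pt)) (in-Tᴿ∣P (leafᶜ {P} Pt))
           (separates-∣⁺ (just Tᴿ) f sep (from (χ x∈l) (leafˡ {P} Pt)) (from (χ y∈l) (leafʳ {P} Pt)))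

  -- sc(R) has no empty member: cl(∅) contains aa|a, but cl(R) does not
  sc-nonempty : ∀ S → InSc R S → ¬ (∀ i → ¬ i Sub.∈ S)
  sc-nonempty S scS empty = ¬¬-char (LeafSet ⟪ R ⟫) l λ (f , χ) →
    let open Restriction (λ t∈R → t∈R) χ
        aaa∈clR = to (scS (tr a a a)) (cl-of-empty (λ (i , i∈S , _) → empty i i∈S) (tr a a a))
    in proj₁ (displaysM⁻ Tᴿ∣P (cl-displayed onLeafSet displays abc∈R aaa∈clR)) refl

  a∈l : a ∈ l
  a∈l = leaf-of-Tᴿ (leafˡ abc∈R)

  b∈l : b ∈ l
  b∈l = leaf-of-Tᴿ (leafʳ abc∈R)

  c∈l : c ∈ l
  c∈l = leaf-of-Tᴿ (leafᶜ abc∈R)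

  B : ℕ → Set
  B x = Reach R a x ⊎ Reach R c x

  Ba : B a
  Ba = inj₁ (refl (leafˡ abc∈R))

  Bc : B c
  Bc = inj₂ (refl (leafᶜ abc∈R))

  B-leaf : ∀ {x} → B x → LeafSet ⟪ R ⟫ x
  B-leaf (inj₁ r) = reach-leaf r
  B-leaf (inj₂ r) = reach-leaf r

  B-step : ∀ {x y z} → tr x y z ∈T R → x ≢ y → B x → B y
  B-step m x≢y (inj₁ r) = inj₁ (reach-snoc r (x≢y , _ , m , leafᶜ m))
  B-step m x≢y (inj₂ r) = inj₂ (reach-snoc r (x≢y , _ , m , leafᶜ m))

  B-resp : ∀ {x y z} → tr x y z ∈T R → x ≢ y → B x ⇔ B y
  B-resp m x≢y = mk⇔ (B-step m x≢y) (B-step (∈T-swap m) (x≢y ∘ sym))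

  E : ℕ → ℕ → Set
  E x y = x ≢ y × ∃[ z ] (tr x y z ∈T R × ¬ (tr x y z ≈T tr a b c) × B z)

  E⊆Adj : ∀ {x y} → E x y → Adj R x y
  E⊆Adj (x≢y , z , m , _ , Bz) = x≢y , z , m , B-leaf Bz

  A : ℕ → Set
  A = Star E a

  A⊆B : ∀ {x} → A x → B x
  A⊆B = along Ba
    where
    along : ∀ {x y} → B x → Star E x y → B y
    along Bx ε = Bx
    along Bx ((x≢y , _ , m , _) ◅ s) = along (B-step m x≢y Bx) s

  -- (S1) and (S2) keep b out of A: an E-walk from a to b is not the single edge
  -- ab (by (S2)), so together with the edge ba it would close a cycle.
  b∉A : ¬ A b
  b∉A Ab = acyclic (walk-cycle Ab a≢b ¬Eab (a≢b ∘ sym , c , ∈T-swap abc∈R , leafᶜ abc∈R))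
    where
    open SimplePaths E E⊆Adj
    a≢b : a ≢ b
    a≢b = proj₁ (Tᴿ-displays _ abc∈R)
    ¬Eab : ¬ E a b
    ¬Eab (_ , z , m , ≉abc , Bz) = S2 z m (λ { refl → ≉abc ≈T-refl }) Bz

  A-resp : ∀ {x y z} → tr x y z ∈T R → x ≢ y → ¬ (tr x y z ≈T tr a b c) →
           (B x → B z) → A x ⇔ A y
  A-resp {x} {y} {z} m x≢y ≉abc Bx→Bz = mk⇔
    (λ Ax → Ax ◅◅ ((x≢y , z , m , ≉abc , Bx→Bz (A⊆B Ax)) ◅ ε))
    (λ Ay → Ay ◅◅ ((x≢y ∘ sym , z , ∈T-swap m , ≉abc ∘ ≈T-trans (≈T-swap y x z) ,
                    Bx→Bz (from (B-resp m x≢y) (A⊆B Ay))) ◅ ε))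

  module SeparatingTree (S : Subset (length R)) (abc∉S : ¬ (⟦ R ⟧ S) (tr a b c))
    {fS fB fA : ℕ → Bool} (χS : Char fS (LeafSet (⟦ R ⟧ S)) l) (χB : Char fB B l) (χA : Char fA A l)
    where

    open Restriction (λ (i , _ , e) → lookup-∈T R i e) χS

    -- the restriction to L_S, with A grouped apart from the other leaves
    Tᴬ : Maybe Tree
    Tᴬ = split fA Tᴿ∣P

    -- and then B grouped apart: ((A, B∖A), rest)
    Tˢ : Maybe Tree
    Tˢ = split fB Tᴬ

    Tˢ-onLeafSet : OnLeafSet (⟦ R ⟧ S) Tˢ
    Tˢ-onLeafSet = split-onLeafSet fB (split-onLeafSet fA onLeafSet)

    Tˢ-displays : ∀ {t} → (⟦ R ⟧ S) t → DisplaysM Tˢ t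
    Tˢ-displays {tr x y z} t∈S@(i , i∈S , e)
      with (x≢y , z∈Tᴿ∣P , sep) ← displaysM⁻ Tᴿ∣P (displays t∈S)
      with (x∈Tᴿ∣P , y∈Tᴿ∣P) ← separates-leaves Tᴿ∣P sep
      = displaysM⁺ Tˢ x≢y (in-Tˢ x∈Tᴬ) (in-Tˢ y∈Tᴬ) (in-Tˢ z∈Tᴬ) separated
      where
      m : tr x y z ∈T R
      m = lookup-∈T R i e

      in-Tᴬ : ∀ {v} → v ∈ mleaves Tᴿ∣P → v ∈ mleaves Tᴬ
      in-Tᴬ = from (∈-split fA Tᴿ∣P)

      in-Tˢ : ∀ {v} → v ∈ mleaves Tᴬ → v ∈ mleaves Tˢ
      in-Tˢ = from (∈-split fB Tᴬ)

      x∈Tᴬ : x ∈ mleaves Tᴬ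
      x∈Tᴬ = in-Tᴬ x∈Tᴿ∣P
      y∈Tᴬ : y ∈ mleaves Tᴬ
      y∈Tᴬ = in-Tᴬ y∈Tᴿ∣P
      z∈Tᴬ : z ∈ mleaves Tᴬ
      z∈Tᴬ = in-Tᴬ z∈Tᴿ∣P

      x∈l : x ∈ l
      x∈l = leaf-of-Tᴿ (leafˡ m)
      y∈l : y ∈ l
      y∈l = leaf-of-Tᴿ (leafʳ m)
      z∈l : z ∈ l
      z∈l = leaf-of-Tᴿ (leafᶜ m)

      ≉abc : ¬ (tr x y z ≈T tr a b c)
      ≉abc q = abc∉S (i , i∈S , ≈T-trans e q)

      fBxy : fB x ≡ fB y
      fBxy = char-≡ χB x∈l y∈l (B-resp m x≢y)

      -- if z is in the B-cluster of x and y, then x and y are in the same A-cluster;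
      -- otherwise the B-cluster separates them from z
      separated : Separates Tˢ x y z
      separated with fB x ≟ᵇ fB z
      ... | no fBx≢fBz = separates-split-root fB Tᴬ x∈Tᴬ y∈Tᴬ z∈Tᴬ fBxy fBx≢fBz
      ... | yes fBx≡fBz = separates-split-part fB Tᴬ (separates-split-part fA Tᴿ∣P sep fAxy) fBxy
        where
        fAxy : fA x ≡ fA y
        fAxy = char-≡ χA x∈l y∈l (A-resp m x≢y ≉abc (char-transfer χB x∈l z∈l fBx≡fBz))

    -- below the root, a, b, c lie in the B-cluster, which splits a ∈ A from b ∉ A
    Tˢ-not-abc : ¬ DisplaysM Tˢ (tr a b c)
    Tˢ-not-abc dabc =
      let (_ , c∈Tˢ , sep) = displaysM⁻ Tˢ dabc
          fBca = char-≡ χB c∈l a∈l (mk⇔ (λ _ → Ba) (λ _ → Bc))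
          sepᴬ = proj₂ (separates-split⁻ fB Tᴬ sep c∈Tˢ) fBca
          fAab = proj₁ (separates-split⁻ fA Tᴿ∣P sepᴬ (to (∈-split fB Tᴬ) c∈Tˢ))
      in b∉A (char-transfer χA a∈l b∈l fAab ε)

  abc∈every-sc : ∀ S → InSc R S → (⟦ R ⟧ S) (tr a b c)
  abc∈every-sc S scS with any? (_∈? S)
  ... | no S-empty = ⊥-elim (sc-nonempty S scS λ i i∈S → S-empty (i , i∈S))
  ... | yes (i , i∈S) = decidable-stable (∈⟦ R ⟧? S (tr a b c)) λ abc∉S →
    ¬¬-char (LeafSet (⟦ R ⟧ S)) l λ (fS , χS) →
    ¬¬-char B l λ (fB , χB) →
    ¬¬-char A l λ (fA , χA) →
    let open SeparatingTree S abc∉S χS χB χA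
        abc∈clS = from (scS (tr a b c)) (cl-extensive abc∈R)
    in Tˢ-not-abc (cl-displayed Tˢ-onLeafSet Tˢ-displays (i , i∈S , ≈T-refl) abc∈clS)

mainTheorem19 : (R : List Triple) → Consistent R → (a b c : ℕ) → tr a b c ∈T R →
    ¬ HasCycle R →
    (∀ d → tr a b d ∈T R → d ≢ c → ¬ (Reach R a d ⊎ Reach R c d)) →
    ((S : Subset (length R)) → InMinSc R S → (⟦ R ⟧ S) (tr a b c)) ×
    (∀ t → (((S : Subset (length R)) → InMinSc R S → (⟦ R ⟧ S) t) ⇔
            ((S : Subset (length R)) → InSc R S → (⟦ R ⟧ S) t)))
mainTheorem19 R (Tᴿ , Tᴿ-rooted , Tᴿ-displays) a b c abc∈R acyclic S2 =
  (λ S minS → abc∈every-sc S (proj₁ minS)) , ⋂-minimal⇔⋂-sc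
  where
  open Separation R Tᴿ Tᴿ-rooted Tᴿ-displays a b c abc∈R acyclic S2
  open MinimalMembers R
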